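{- Let $P=(G,S,X_0,X,Y_0,Y,f)$ be a seeded precoloring of a $P_6$-free graph satisfying: (ii) $G|S$ is connected and no vertex of $V(G)\setminus S$ is complete to $S$; (iii) $Y_0=V(G)\setminus(N(S)\cup X_0\cup S)$; (iv) no vertex of $V(G)\setminus(Y_0\cup X_0)$ is mixed on an edge of $Y_0$. Let $P'=(G',S',X_0',X',Y_0',Y',f')$ be a normal subcase of $P$ such that $Y_0'=V(G')\setminus(N_{G'}(S')\cup X_0'\cup S')$. Then no vertex $v\in Y_0\setminus(S'\cup Y_0')$ has both a neighbor in $S'$ and a neighbor in $Y_0'$.
   Context: A seeded precoloring of a graph $G$ is a $7$-tuple $(G,S,X_0,X,Y_0,Y,f)$ where $S,X_0,X,Y_0,Y$ are pairwise disjoint with union $V(G)$ and $f:S\cup X_0\to\{1,2,3,4\}$ is a proper coloring of $G|(S\cup X_0)$. For a set $X$, $N(X)=(\bigcup_{v\in X}N(v))\setminus X$. A vertex $v$ is mixed on an edge $ab$ if it is adjacent to exactly one of $a,b$; an edge of a set $Z$ is an edge with both ends in $Z$. Given the seeded precoloring $P$ above, a seeded precoloring $P'$ is a normal subcase of $P$ if $P'=(G\setminus Z,S',X_0',X',Y_0',Y',f')$ where: $Z\subseteq Y_0$; $G|S'$ is connected and $S\subseteq S'\subseteq S\cup X\cup Y_0\cup Y$; every vertex of $X_0'\cap Y_0$ has a neighbor in $S'$; $X_0\subseteq X_0'\subseteq X_0\cup X\cup Y_0\cup Y$; and $f'=f\cup g$ for some function $g:(S'\cup X_0')\setminus(S\cup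 X_0)\to\{1,2,3,4\}$. $G$ is $P_6$-free if it has no induced six-vertex path. -}

module Defs where

open import Data.Nat using (ℕ; suc)
open import Data.Fin using (Fin; toℕ)
open import Data.Fin.Subset using (Subset; _∈_; _∉_; _⊆_; _∩_; _∪_; ∁; ⊥; ⊤)
open import Data.Product using (Σ; _×_; ∃-syntax)
open import Data.Sum using (_⊎_)
open import Relation.Nullary using (¬_; Dec)
open import Relation.Binary.PropositionalEquality using (_≡_; _≢_)
open import Function.Definitions using (Injective)
open import Function.Bundles using (_⇔_)

record Graph (n : ℕ) : Set₁ where
  field
    E      : Fin n → Fin n → Set
    E-sym  : ∀ {u v} → E u v → E v u
    E-irr  : ∀ {v} → ¬ E v v
    E-dec  : ∀ u v → Dec (E u v)
open Graph public

Colour : Set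
Colour = Fin 4

module _ {n : ℕ} (G : Graph n) where

  data WalkIn (A : Subset n) : Fin n → Fin n → Set where
    here : ∀ {v} → v ∈ A → WalkIn A v v
    step : ∀ {u w v} → u ∈ A → E G u w → WalkIn A w v → WalkIn A u v

  Connected : Subset n → Set
  Connected A = ∀ u v → u ∈ A → v ∈ A → WalkIn A u v

  -- v is in N(A) computed in the induced subgraph G|U
  InNbhd : Subset n → Subset n → Fin n → Set
  InNbhd U A v = v ∈ U × v ∉ A × ∃[ a ] (a ∈ A × E G v a)

  CompleteTo : Fin n → Subset n → Set
  CompleteTo v A = ∀ a → a ∈ A → E G v a

  MixedOn : Fin n → Fin n → Fin n → Set
  MixedOn v a b = (E G v a × ¬ E G v b) ⊎ (¬ E G v a × E G v b)

  Partition5 : Subset n → Subset n → Subset n → Subset n → Subset n → Subset n → Set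
  Partition5 U A B C D F =
    (A ∩ B ≡ ⊥) × (A ∩ C ≡ ⊥) × (A ∩ D ≡ ⊥) × (A ∩ F ≡ ⊥) ×
    (B ∩ C ≡ ⊥) × (B ∩ D ≡ ⊥) × (B ∩ F ≡ ⊥) ×
    (C ∩ D ≡ ⊥) × (C ∩ F ≡ ⊥) × (D ∩ F ≡ ⊥) ×
    (A ∪ B ∪ C ∪ D ∪ F ≡ U)

  ProperOn : Subset n → (Fin n → Colour) → Set
  ProperOn A f = ∀ u v → u ∈ A → v ∈ A → E G u v → f u ≢ f v

  -- seeded precoloring (H,S,X0,X,Y0,Y,f) of the induced subgraph H = G|U;
  -- f : S ∪ X0 → {1,2,3,4} is represented by a total function whose values
  -- outside S ∪ X0 are irrelevant.
  SeededPrecoloring : Subset n → Subset n → Subset n → Subset n → Subset n → Subset n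
                    → (Fin n → Colour) → Set
  SeededPrecoloring U S X0 X Y0 Y f =
    Partition5 U S X0 X Y0 Y × ProperOn (S ∪ X0) f

  -- P' = (G \ Z, S', X0', X', Y0', Y', f') is a normal subcase of P = (G,S,X0,X,Y0,Y,f)
  NormalSubcase : (S X0 X Y0 Y : Subset n) (f : Fin n → Colour)
                  (Z S' X0' X' Y0' Y' : Subset n) (f' : Fin n → Colour) → Set
  NormalSubcase S X0 X Y0 Y f Z S' X0' X' Y0' Y' f' =
    SeededPrecoloring (∁ Z) S' X0' X' Y0' Y' f' ×
    Z ⊆ Y0 ×
    Connected S' ×
    S ⊆ S' × S' ⊆ (S ∪ X ∪ Y0 ∪ Y) ×
    (∀ v → v ∈ X0' → v ∈ Y0 → ∃[ s ] (s ∈ S' × E G v s)) ×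
    X0 ⊆ X0' × X0' ⊆ (X0 ∪ X ∪ Y0 ∪ Y) ×
    (∀ v → v ∈ (S ∪ X0) → f' v ≡ f v)

  Consecutive : Fin 6 → Fin 6 → Set
  Consecutive i j = toℕ j ≡ suc (toℕ i) ⊎ toℕ i ≡ suc (toℕ j)

  P6Free : Set
  P6Free = ¬ (Σ (Fin 6 → Fin n) λ p →
                 Injective _≡_ _≡_ p × (∀ i j → E G (p i) (p j) ⇔ Consecutive i j))

-- Suppose v ∈ Y0 has neighbours s ∈ S' and y ∈ Y0'. Then y ∈ Y0, so every neighbour w ∈ S' of v
-- is mixed on the Y0-edge vy; by (iv) w ∈ Y0, hence w has no neighbour in S. Take a shortest
-- path q w₁ w₂ … in G|S' from a neighbour q of v to S. With three or more edges, y v q w₁ w₂ w₃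
-- is an induced P₆. With two edges, w₁ ∉ S has a neighbour in S but is not complete to the
-- connected set S, so it is mixed on an edge ab of S and y v q w₁ a b is an induced P₆.
-- Shorter paths contradict what is known about q.
module Submission where

open import Defs
open import Data.Nat as ℕ using (ℕ; zero; suc; _≤_; s≤s)
open import Data.Nat.Properties using (suc-injective; ≤-refl; <⇒≤)
open import Data.Fin using (Fin; zero; suc; toℕ)
open import Data.Fin.Properties using (all?; _≟_)
open import Data.Fin.Subset using (Subset; _∈_; _∉_; _⊆_; _∩_; ∁; ⊤) renaming (⊥ to ∅)
open import Data.Fin.Subset.Properties using (∈⊤; ∉⊥; x∈p∩q⁺)
open import Data.Vec using (Vec; []; _∷_; lookup)
open import Data.Vec.Relation.Unary.All using (All; []; _∷_)
open import Data.Vec.Relation.Unary.All.Properties using (lookup⁺)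
open import Data.Product using (_×_; ∃-syntax; _,_; proj₁)
open import Data.Sum as Sum using (_⊎_; inj₁; inj₂)
open import Data.Empty using (⊥; ⊥-elim)
open import Relation.Nullary using (¬_; Dec; yes; no)
open import Relation.Nullary.Decidable using (from-yes; _⊎-dec_; _→-dec_)
open import Relation.Binary.PropositionalEquality using (_≡_; refl; sym; cong; subst)
open import Function using (_∘_; const)
open import Function.Bundles using (_⇔_; mk⇔; Equivalence)
open import Function.Properties.Equivalence as ⇔ using ()
open Equivalence using (to; from)

-- Consecutive from Defs, for paths of any length; at m = 6 the two agree definitionally.
AreConsecutive : ∀ {m} → Fin m → Fin m → Set
AreConsecutive i j = toℕ j ≡ suc (toℕ i) ⊎ toℕ i ≡ suc (toℕ j)

areConsecutive? : ∀ {m} (i j : Fin m) → Dec (AreConsecutive i j)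
areConsecutive? i j = (toℕ j ℕ.≟ suc (toℕ i)) ⊎-dec (toℕ i ℕ.≟ suc (toℕ j))

consecutive-suc⇔ : ∀ {m} (i j : Fin m) → AreConsecutive (suc i) (suc j) ⇔ AreConsecutive i j
consecutive-suc⇔ i j = mk⇔ (Sum.map suc-injective suc-injective) (Sum.map (cong suc) (cong suc))

-- Checked by evaluation; it fails on three vertices, whose two ends have the same neighbour.
consecutive-determined-by-neighbours : (i j : Fin 6) →
  (∀ k → AreConsecutive i k → AreConsecutive j k) →
  (∀ k → AreConsecutive j k → AreConsecutive i k) → i ≡ j
consecutive-determined-by-neighbours = from-yes
  (all? {n = 6} λ i → all? λ j →
     (all? λ k → areConsecutive? i k →-dec areConsecutive? j k) →-dec
     (all? λ k → areConsecutive? j k →-dec areConsecutive? i k) →-dec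
     i ≟ j)

module _ {n : ℕ} (G : Graph n) where

  data IsInducedPath : ∀ {m} → Vec (Fin n) (suc m) → Set where
    end  : ∀ {x} → IsInducedPath (x ∷ [])
    link : ∀ {m x y} {zs : Vec (Fin n) m} →
           E G x y → All (¬_ ∘ E G x) zs → IsInducedPath (y ∷ zs) → IsInducedPath (x ∷ y ∷ zs)

  head-adjacency : ∀ {m} {xs : Vec (Fin n) (suc m)} → IsInducedPath xs →
                   ∀ j → E G (lookup xs zero) (lookup xs j) ⇔ AreConsecutive zero j
  head-adjacency P zero = mk⇔ (⊥-elim ∘ E-irr G) λ { (inj₁ ()) ; (inj₂ ()) }
  head-adjacency (link x~y _ _) (suc zero) = mk⇔ (const (inj₁ refl)) (const x~y)
  head-adjacency (link _ x≁zs _) (suc (suc j)) =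
    mk⇔ (⊥-elim ∘ lookup⁺ x≁zs j) λ { (inj₁ ()) ; (inj₂ ()) }

  lookup-adjacency : ∀ {m} {xs : Vec (Fin n) (suc m)} → IsInducedPath xs →
                     ∀ i j → E G (lookup xs i) (lookup xs j) ⇔ AreConsecutive i j
  lookup-adjacency P zero j = head-adjacency P j
  lookup-adjacency P (suc i) zero = mk⇔ (Sum.swap ∘ to (head-adjacency P (suc i)) ∘ E-sym G)
                                        (E-sym G ∘ from (head-adjacency P (suc i)) ∘ Sum.swap)
  lookup-adjacency (link _ _ P) (suc i) (suc j) =
    ⇔.trans (lookup-adjacency P i j) (⇔.sym (consecutive-suc⇔ i j))

  induced-P₆⇒¬P6Free : {xs : Vec (Fin n) 6} → IsInducedPath xs → ¬ P6Free G
  induced-P₆⇒¬P6Free {xs} P p6 = p6 (lookup xs , injective , lookup-adjacency P)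
    where
    injective : ∀ {i j} → lookup xs i ≡ lookup xs j → i ≡ j
    injective {i} {j} eq = consecutive-determined-by-neighbours i j
      (λ k → to (lookup-adjacency P j k) ∘ subst (λ x → E G x (lookup xs k)) eq ∘ from (lookup-adjacency P i k))
      (λ k → to (lookup-adjacency P i k) ∘ subst (λ x → E G x (lookup xs k)) (sym eq) ∘ from (lookup-adjacency P j k))

  length : ∀ {A u w} → WalkIn G A u w → ℕ
  length (here _)     = 0
  length (step _ _ W) = suc (length W)

  walk-start∈ : ∀ {A u w} → WalkIn G A u w → u ∈ A
  walk-start∈ (here u∈A)     = u∈A
  walk-start∈ (step u∈A _ _) = u∈A

  unmixed-adjacency-along-walk : ∀ {A u a c} →
    (∀ a b → a ∈ A → b ∈ A → E G a b → ¬ MixedOn G u a b) →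
    WalkIn G A a c → E G u a → E G u c
  unmixed-adjacency-along-walk unmixed (here _) u~a = u~a
  unmixed-adjacency-along-walk {u = u} unmixed (step {w = w} a∈A a~w W) u~a with E-dec G u w
  ... | yes u~w = unmixed-adjacency-along-walk unmixed W u~w
  ... | no  u≁w = ⊥-elim (unmixed _ w a∈A (walk-start∈ W) a~w (inj₁ (u~a , u≁w)))

  connected-unmixed⇒complete : ∀ {A u a} → Connected G A →
    (∀ a b → a ∈ A → b ∈ A → E G a b → ¬ MixedOn G u a b) →
    a ∈ A → E G u a → CompleteTo G u A
  connected-unmixed⇒complete A-connected unmixed a∈A u~a c c∈A =
    unmixed-adjacency-along-walk unmixed (A-connected _ c a∈A c∈A) u~a

  ¬InNbhd⇒anticomplete : ∀ {U A v} → v ∈ U → v ∉ A → ¬ InNbhd G U A v → ∀ a → a ∈ A → ¬ E G v a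
  ¬InNbhd⇒anticomplete v∈U v∉A v∉N a a∈A v~a = v∉N (v∈U , v∉A , a , a∈A , v~a)

  anticomplete⇒¬InNbhd : ∀ {U A v} → (∀ a → a ∈ A → ¬ E G v a) → ¬ InNbhd G U A v
  anticomplete⇒¬InNbhd v≁A (_ , _ , a , a∈A , v~a) = v≁A a a∈A v~a

∩≡∅⇒∉ : ∀ {n} {p q : Subset n} {x} → p ∩ q ≡ ∅ → x ∈ p → x ∉ q
∩≡∅⇒∉ {x = x} p∩q≡∅ x∈p x∈q = ∉⊥ (subst (x ∈_) p∩q≡∅ (x∈p∩q⁺ (x∈p , x∈q)))

module NoBridge {n : ℕ} (G : Graph n) (p6 : P6Free G) {S S' : Subset n}
  (S-connected : Connected G S) (S-uncovered : ∀ w → w ∉ S → ¬ CompleteTo G w S)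
  (S'-connected : Connected G S') (S⊆S' : S ⊆ S')
  {v y : Fin n} (v~y : E G v y) (v≁S : ∀ a → a ∈ S → ¬ E G v a) (y≁S' : ∀ a → a ∈ S' → ¬ E G y a)
  (S'-neighbours-of-v≁S : ∀ w → w ∈ S' → E G v w → ∀ a → a ∈ S → ¬ E G w a) where

  ¬mixed-beyond-S'-neighbour : ∀ {q w a b} → q ∈ S' → w ∈ S' → E G v q → E G q w → ¬ E G v w →
    a ∈ S → b ∈ S → E G a b → E G w a → ¬ E G w b → ¬ P6Free G
  ¬mixed-beyond-S'-neighbour {q} {a = a} {b} q∈S' w∈S' v~q q~w v≁w a∈S b∈S a~b w~a w≁b =
    induced-P₆⇒¬P6Free G
      (link (E-sym G v~y) (≁S' q∈S' ∷ ≁S' w∈S' ∷ ≁S' (S⊆S' a∈S) ∷ ≁S' (S⊆S' b∈S) ∷ [])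
      (link v~q (v≁w ∷ v≁S a a∈S ∷ v≁S b b∈S ∷ [])
      (link q~w (q≁S a a∈S ∷ q≁S b b∈S ∷ [])
      (link w~a (w≁b ∷ [])
      (link a~b [] end)))))
    where
    ≁S' : ∀ {x} → x ∈ S' → ¬ E G y x
    ≁S' = y≁S' _
    q≁S : ∀ a → a ∈ S → ¬ E G q a
    q≁S = S'-neighbours-of-v≁S q q∈S' v~q

  -- k bounds the length, so every shortcut of the walk falls under the induction hypothesis.
  no-walk-from-neighbour-to-S : ∀ k {q t} (W : WalkIn G S' q t) → length G W ≤ k → E G v q → t ∈ S → ⊥
  no-walk-from-neighbour-to-S k (here _) _ v~t t∈S = v≁S _ t∈S v~t
  no-walk-from-neighbour-to-S k (step q∈S' q~t (here _)) _ v~q t∈S =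
    S'-neighbours-of-v≁S _ q∈S' v~q _ t∈S q~t
  no-walk-from-neighbour-to-S zero (step _ _ (step _ _ _)) () _ _
  no-walk-from-neighbour-to-S (suc k) {q} (step {w = w} q∈S' q~w (step w∈S' w~t (here _)))
    (s≤s len≤) v~q t∈S =
    S-uncovered w w∉S (connected-unmixed⇒complete G S-connected unmixed t∈S w~t)
    where
    v≁w : ¬ E G v w
    v≁w v~w = no-walk-from-neighbour-to-S k (step w∈S' w~t (here (S⊆S' t∈S))) len≤ v~w t∈S
    w∉S : w ∉ S
    w∉S w∈S = S'-neighbours-of-v≁S q q∈S' v~q w w∈S q~w
    unmixed : ∀ a b → a ∈ S → b ∈ S → E G a b → ¬ MixedOn G w a b
    unmixed a b a∈S b∈S a~b (inj₁ (w~a , w≁b)) =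
      ¬mixed-beyond-S'-neighbour q∈S' w∈S' v~q q~w v≁w a∈S b∈S a~b w~a w≁b p6
    unmixed a b a∈S b∈S a~b (inj₂ (w≁a , w~b)) =
      ¬mixed-beyond-S'-neighbour q∈S' w∈S' v~q q~w v≁w b∈S a∈S (E-sym G a~b) w~b w≁a p6
  no-walk-from-neighbour-to-S (suc k) {q} {t}
    (step {w = w₁} q∈S' q~w₁ (step {w = w₂} w₁∈S' w₁~w₂ (step {w = w₃} w₂∈S' w₂~w₃ W))) (s≤s len≤) v~q t∈S =
    induced-P₆⇒¬P6Free G
      (link (E-sym G v~y) (≁S' q∈S' ∷ ≁S' w₁∈S' ∷ ≁S' w₂∈S' ∷ ≁S' (walk-start∈ G W) ∷ [])
      (link v~q (v≁w₁ ∷ v≁w₂ ∷ v≁w₃ ∷ [])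
      (link q~w₁ (q≁w₂ ∷ q≁w₃ ∷ [])
      (link w₁~w₂ (w₁≁w₃ ∷ [])
      (link w₂~w₃ [] end)))))
      p6
    where
    shorter : ∀ {q'} (W' : WalkIn G S' q' t) → length G W' ≤ k → ¬ E G v q'
    shorter W' len'≤ v~q' = no-walk-from-neighbour-to-S k W' len'≤ v~q' t∈S
    ≁S' : ∀ {x} → x ∈ S' → ¬ E G y x
    ≁S' = y≁S' _
    v≁w₁ : ¬ E G v w₁
    v≁w₁ = shorter (step w₁∈S' w₁~w₂ (step w₂∈S' w₂~w₃ W)) len≤
    v≁w₂ : ¬ E G v w₂
    v≁w₂ = shorter (step w₂∈S' w₂~w₃ W) (<⇒≤ len≤)
    v≁w₃ : ¬ E G v w₃
    v≁w₃ = shorter W (<⇒≤ (<⇒≤ len≤))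
    q≁w₂ : ¬ E G q w₂
    q≁w₂ q~w₂ = shorter (step q∈S' q~w₂ (step w₂∈S' w₂~w₃ W)) len≤ v~q
    q≁w₃ : ¬ E G q w₃
    q≁w₃ q~w₃ = shorter (step q∈S' q~w₃ W) (<⇒≤ len≤) v~q
    w₁≁w₃ : ¬ E G w₁ w₃
    w₁≁w₃ w₁~w₃ = shorter (step q∈S' q~w₁ (step w₁∈S' w₁~w₃ W)) len≤ v~q

  -- Applying (ii) to v itself supplies the vertex of S that the walk must reach.
  v≁S' : v ∉ S → ∀ s → s ∈ S' → ¬ E G v s
  v≁S' v∉S s s∈S' v~s = S-uncovered v v∉S λ a a∈S →
    ⊥-elim (no-walk-from-neighbour-to-S _ (S'-connected s a s∈S' (S⊆S' a∈S)) ≤-refl v~s a∈S)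

lemma2p4 : ∀ {n : ℕ} (G : Graph n)
           (S X0 X Y0 Y : Subset n) (f : Fin n → Colour)
           (Z S' X0' X' Y0' Y' : Subset n) (f' : Fin n → Colour) →
           P6Free G →
           SeededPrecoloring G ⊤ S X0 X Y0 Y f →
           Connected G S →
           (∀ v → v ∉ S → ¬ CompleteTo G v S) →
           (∀ v → v ∈ Y0 ⇔ (¬ InNbhd G ⊤ S v × v ∉ X0 × v ∉ S)) →
           (∀ v a b → v ∉ Y0 → v ∉ X0 → a ∈ Y0 → b ∈ Y0 → E G a b → ¬ MixedOn G v a b) →
           NormalSubcase G S X0 X Y0 Y f Z S' X0' X' Y0' Y' f' →
           (∀ v → v ∈ Y0' ⇔ (v ∈ ∁ Z × ¬ InNbhd G (∁ Z) S' v × v ∉ X0' × v ∉ S')) →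
           ∀ v → v ∈ Y0 → v ∉ S' → v ∉ Y0' →
           ¬ ((∃[ s ] (s ∈ S' × E G v s)) × (∃[ y ] (y ∈ Y0' × E G v y)))
lemma2p4 G S X0 X Y0 Y f Z S' X0' X' Y0' Y' f' p6 _ S-connected S-uncovered Y0-def Y0-unmixed
  (((S'∩X0'≡∅ , _) , _) , _ , S'-connected , S⊆S' , _ , _ , X0⊆X0' , _) Y0'-def v v∈Y0 v∉S' _
  ((s , s∈S' , v~s) , (y , y∈Y0' , v~y)) =
  NoBridge.v≁S' G p6 S-connected S-uncovered S'-connected S⊆S' v~y v≁S y≁S' S'-neighbours-of-v≁S
    v∉S s s∈S' v~s
  where
  v∉S : v ∉ S
  v∉S = v∉S' ∘ S⊆S'
  v≁S : ∀ a → a ∈ S → ¬ E G v a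
  v≁S = ¬InNbhd⇒anticomplete G ∈⊤ v∉S (proj₁ (to (Y0-def v) v∈Y0))
  y≁S' : ∀ a → a ∈ S' → ¬ E G y a
  y≁S' with to (Y0'-def y) y∈Y0'
  ... | y∈∁Z , y∉N[S'] , _ , y∉S' = ¬InNbhd⇒anticomplete G y∈∁Z y∉S' y∉N[S']
  y∈Y0 : y ∈ Y0
  y∈Y0 with to (Y0'-def y) y∈Y0'
  ... | _ , _ , y∉X0' , y∉S' =
    from (Y0-def y) (anticomplete⇒¬InNbhd G (λ a → y≁S' a ∘ S⊆S') , y∉X0' ∘ X0⊆X0' , y∉S' ∘ S⊆S')
  S'-neighbours-of-v≁S : ∀ w → w ∈ S' → E G v w → ∀ a → a ∈ S → ¬ E G w a
  S'-neighbours-of-v≁S w w∈S' v~w a a∈S w~a =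
    Y0-unmixed w v y w∉Y0 (∩≡∅⇒∉ S'∩X0'≡∅ w∈S' ∘ X0⊆X0') v∈Y0 y∈Y0 v~y
      (inj₁ (E-sym G v~w , y≁S' w w∈S' ∘ E-sym G))
    where
    w∉Y0 : w ∉ Y0
    w∉Y0 w∈Y0 = proj₁ (to (Y0-def w) w∈Y0)
      (∈⊤ , (λ w∈S → v≁S w w∈S v~w) , a , a∈S , w~a)
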